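{- For every $n\ge4$ there exist two distinct full binary trees $T_1$ and $T_2$, each with $n$ internal nodes, such that $p_{T_1}=p_{T_2}$.
   Context: A full binary tree is a rooted ordered tree whose nodes are leaves or internal nodes with exactly two children. The tree polynomial $p_T(x,y)\in\mathbb{R}[x,y]$ of a full binary tree $T$ is defined by labeling each edge from a parent to its left child by $x$ and to its right child by $y$, associating to each root-to-leaf path the monomial equal to the product of its edge labels, and letting $p_T$ be the sum of these monomials over all leaves. -}

module Defs where

open import Data.Nat using (ℕ; zero; suc; _+_)
open import Data.Nat.Properties using (_≟_)
open import Data.Product using (_×_; _,_)
open import Data.List using (List; []; _∷_; _++_; map; length; filter)
open import Relation.Nullary.Decidable using (_×-dec_)

data FBT : Set where
  leaf : FBT
  node : FBT → FBT → FBT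

internal : FBT → ℕ
internal leaf       = 0
internal (node l r) = suc (internal l + internal r)

-- A monomial x^i y^j is represented by its exponent pair (i , j).
Monomial : Set
Monomial = ℕ × ℕ

mulX : Monomial → Monomial
mulX (i , j) = (suc i , j)

mulY : Monomial → Monomial
mulY (i , j) = (i , suc j)

-- The list of root-to-leaf monomials (one per leaf, left-to-right):
-- left edges are labelled x, right edges y.
leafMonomials : FBT → List Monomial
leafMonomials leaf       = (0 , 0) ∷ []
leafMonomials (node l r) = map mulX (leafMonomials l) ++ map mulY (leafMonomials r)

-- Tree polynomial p_T, given by its coefficient function:
-- coefficient of x^i y^j = number of leaves whose path monomial is x^i y^j.
treePoly : FBT → ℕ → ℕ → ℕ
treePoly T i j =
  length (filter (λ { (a , b) → (a ≟ i) ×-dec (b ≟ j) }) (leafMonomials T))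

-- The tree polynomial only counts the leaves with each path monomial, so two
-- trees whose lists of leaf monomials are permutations of each other have the
-- same polynomial.  Two distinct trees with 4 internal nodes share the leaf
-- monomials x², xy, x²y, xy², y²; grafting both onto the bottom of a left
-- spine of length k multiplies every monomial by x^k on both sides, giving
-- distinct trees with 4 + k internal nodes and equal polynomials.
module Submission where

open import Defs
open import Data.Nat using (ℕ; zero; suc; _+_; _∸_; _≤_)
open import Data.Nat.Properties using (+-identityʳ; m∸n+n≡m)
open import Data.Product using (Σ; _×_; _,_)
open import Data.List.Relation.Binary.Permutation.Propositional
  using (_↭_; ↭-refl; ↭-prep; ↭-swap; ↭-trans)
open import Data.List.Relation.Binary.Permutation.Propositional.Properties
  using (↭-length; filter-↭; map⁺; ++⁺)
open import Relation.Binary.PropositionalEquality using (_≡_; refl; cong; trans)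
open import Relation.Nullary using (¬_)

infix 4 _≈ₘ_

-- A record rather than a synonym, so that the trees stay inferable:
-- leafMonomials is not injective.
record _≈ₘ_ (T₁ T₂ : FBT) : Set where
  constructor leafMonomials-↭
  field ↭-leafMonomials : leafMonomials T₁ ↭ leafMonomials T₂

≈ₘ⇒treePoly≡ : ∀ {T₁ T₂} → T₁ ≈ₘ T₂ → (i j : ℕ) → treePoly T₁ i j ≡ treePoly T₂ i j
≈ₘ⇒treePoly≡ (leafMonomials-↭ p) i j = ↭-length (filter-↭ _ p)

≈ₘ-refl : ∀ {T} → T ≈ₘ T
≈ₘ-refl = leafMonomials-↭ ↭-refl

node-cong-≈ₘ : ∀ {T₁ T₂ S₁ S₂} → T₁ ≈ₘ T₂ → S₁ ≈ₘ S₂ → node T₁ S₁ ≈ₘ node T₂ S₂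
node-cong-≈ₘ (leafMonomials-↭ p) (leafMonomials-↭ q) =
  leafMonomials-↭ (++⁺ (map⁺ mulX p) (map⁺ mulY q))

leftSpine : ℕ → FBT → FBT
leftSpine zero    T = T
leftSpine (suc k) T = node (leftSpine k T) leaf

internal-leftSpine : ∀ k T → internal (leftSpine k T) ≡ k + internal T
internal-leftSpine zero    T = refl
internal-leftSpine (suc k) T =
  cong suc (trans (+-identityʳ _) (internal-leftSpine k T))

node-injectiveˡ : ∀ {T₁ T₂ S₁ S₂} → node T₁ S₁ ≡ node T₂ S₂ → T₁ ≡ T₂
node-injectiveˡ refl = refl

leftSpine-injective : ∀ k {T₁ T₂} → leftSpine k T₁ ≡ leftSpine k T₂ → T₁ ≡ T₂
leftSpine-injective zero    eq = eq
leftSpine-injective (suc k) eq = leftSpine-injective k (node-injectiveˡ eq)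

leftSpine-cong-≈ₘ : ∀ k {T₁ T₂} → T₁ ≈ₘ T₂ → leftSpine k T₁ ≈ₘ leftSpine k T₂
leftSpine-cong-≈ₘ zero    T₁≈T₂ = T₁≈T₂
leftSpine-cong-≈ₘ (suc k) T₁≈T₂ = node-cong-≈ₘ (leftSpine-cong-≈ₘ k T₁≈T₂) ≈ₘ-refl

tree₁ tree₂ : FBT
tree₁ = node (node leaf leaf) (node (node leaf leaf) leaf)
tree₂ = node (node leaf (node leaf leaf)) (node leaf leaf)

tree₁≈ₘtree₂ : tree₁ ≈ₘ tree₂
tree₁≈ₘtree₂ =
  leafMonomials-↭ (↭-prep _ (↭-trans (↭-swap _ _ ↭-refl) (↭-prep _ (↭-swap _ _ ↭-refl))))

proposition5 : (n : ℕ) → 4 ≤ n →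
    Σ FBT λ T₁ → Σ FBT λ T₂ →
    ¬ (T₁ ≡ T₂) × internal T₁ ≡ n × internal T₂ ≡ n ×
    ((i j : ℕ) → treePoly T₁ i j ≡ treePoly T₂ i j)
proposition5 n 4≤n =
  leftSpine k tree₁ , leftSpine k tree₂ ,
  (λ eq → tree₁≢tree₂ (leftSpine-injective k eq)) ,
  trans (internal-leftSpine k tree₁) (m∸n+n≡m 4≤n) ,
  trans (internal-leftSpine k tree₂) (m∸n+n≡m 4≤n) ,
  ≈ₘ⇒treePoly≡ (leftSpine-cong-≈ₘ k tree₁≈ₘtree₂)
  where
  k : ℕ
  k = n ∸ 4

  tree₁≢tree₂ : ¬ (tree₁ ≡ tree₂)
  tree₁≢tree₂ ()
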